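{- Let $p>q\ge1$ be integers and consider an instance $(J,(d'_p,d_p)[1\ldots N],(d'_q,d_q)[1\ldots N])$ of $\operatorname{AUX}(p,q)$. If the associated stacked scheduling instance $J\cup J_{sep}\cup J^I_p\cup J^O_p\cup J^I_q\cup J^O_q$ has a feasible schedule, then the instance is a yes-instance of $\operatorname{AUX}(p,q)$.
   Context: A task $([r,d],l)$ has release time $r\in\mathbb{Z}$, deadline $d\in\mathbb{Z}$ and processing time $l$ (a positive integer). A feasible schedule of a set of tasks assigns start times $t(i)\in\mathbb{R}$ with $r_i\le t(i)\le d_i-l_i$ such that the intervals $[t(i),t(i)+l_i)$ are pairwise disjoint. Problem $\operatorname{AUX}(p,q)$: the input is a set $J$ of tasks with processing times in $\{p,q\}$ and non-negative release times, and integer sequences $(d'_p[i],d_p[i])$, $(d'_q[i],d_q[i])$, $i=1,\ldots,N$, with $d'_p[1]\le d_p[1]\le d'_p[2]\le\cdots\le d'_p[N]\le d_p[N]$, $d'_q[1]\le d_q[1]\le d'_q[2]\le\cdots\le d'_q[N]\le d_q[N]$, and $d_p[i]\le d'_q[i]$ for all $i$. With $J_p[i]=([0,d_p[i]],p)$ and $J_q[i]=([0,d_q[i]],q)$, it is a yes-instance if there is a feasible schedule of $J\cup J_p\cup J_q$ in which, for each $i$, $J_p[i]$ completes by $d'_p[i]$ or $J_q[i]$ completes by $d'_q[i]$. Stacked scheduling instance: let $t_i=-(p+2q)i+p+q$ for $i=1,\ldots,N$. Let $J_{sep}[i]=([t_i,t_i+q],q)$. For $l\in\{p,q\}$ and $i=1,\ldots,N$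 let $J^I_l[i]=([t_i-l,d'_l[i]],l)$ and $J^O_l[i]=([t_i-p-q,d_l[i]],l)$. The stacked instance is the task set $J\cup J_{sep}\cup J^I_p\cup J^O_p\cup J^I_q\cup J^O_q$.
   Formalization: Start times of all schedules, for the stacked instance and for the instance of AUX(p,q) alike, are taken in ℚ instead of ℝ. -}

module Defs where

open import Data.Nat as ℕ using (ℕ; suc)
open import Data.Integer as ℤ using (ℤ; +_)
open import Data.Rational as ℚ using (ℚ)
open import Data.Fin using (Fin; toℕ)
open import Data.Sum using (_⊎_; inj₁; inj₂)
open import Data.Product using (Σ; _×_; _,_)
open import Relation.Binary.PropositionalEquality using (_≡_; _≢_)

record Task : Set where
  constructor task
  field
    release  : ℤ
    deadline : ℤ
    len      : ℕ
open Task public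

⟦_⟧ℤ : ℤ → ℚ
⟦ z ⟧ℤ = z ℚ./ 1

⟦_⟧ℕ : ℕ → ℚ
⟦ n ⟧ℕ = ⟦ + n ⟧ℤ

completion : Task → ℚ → ℚ
completion T s = s ℚ.+ ⟦ len T ⟧ℕ

-- A schedule of a task family T : I → Task (a (multi)set of tasks indexed by I)
-- is feasible if every task runs inside its window and distinct tasks'
-- intervals [t(i), t(i)+l_i) are disjoint.
IsFeasibleSchedule : {I : Set} → (I → Task) → (I → ℚ) → Set
IsFeasibleSchedule {I} T σ =
  (∀ i → (⟦ release (T i) ⟧ℤ ℚ.≤ σ i) × (completion (T i) (σ i) ℚ.≤ ⟦ deadline (T i) ⟧ℤ))
  × (∀ i j → i ≢ j →
       (completion (T i) (σ i) ℚ.≤ σ j) ⊎ (completion (T j) (σ j) ℚ.≤ σ i))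

Feasible : {I : Set} → (I → Task) → Set
Feasible {I} T = Σ (I → ℚ) λ σ → IsFeasibleSchedule T σ

-- Sequences indexed by i = 1..N are represented by Fin N (index k ↦ i = k+1).
-- The chain  a'[1] ≤ a[1] ≤ a'[2] ≤ … ≤ a'[N] ≤ a[N]
Chain : (N : ℕ) → (Fin N → ℤ) → (Fin N → ℤ) → Set
Chain N a' a =
  (∀ i → a' i ℤ.≤ a i) × (∀ (i j : Fin N) → toℕ j ≡ suc (toℕ i) → a i ℤ.≤ a' j)

record AUXInstance (p q : ℕ) : Set where
  field
    m     : ℕ
    J     : Fin m → Task
    N     : ℕ
    d'p   : Fin N → ℤ
    dp    : Fin N → ℤ
    d'q   : Fin N → ℤ
    dq    : Fin N → ℤ

ValidAUX : (p q : ℕ) → AUXInstance p q → Set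
ValidAUX p q inst =
  (∀ k → (len (J k) ≡ p ⊎ len (J k) ≡ q) × (+ 0 ℤ.≤ release (J k)))
  × Chain N d'p dp × Chain N d'q dq
  × (∀ i → dp i ℤ.≤ d'q i)
  where open AUXInstance inst

data AuxIdx (m N : ℕ) : Set where
  jIdx  : Fin m → AuxIdx m N
  pIdx  : Fin N → AuxIdx m N
  qIdx  : Fin N → AuxIdx m N

auxTasks : (p q : ℕ) (inst : AUXInstance p q) →
           AuxIdx (AUXInstance.m inst) (AUXInstance.N inst) → Task
auxTasks p q inst (jIdx k) = AUXInstance.J inst k
auxTasks p q inst (pIdx i) = task (+ 0) (AUXInstance.dp inst i) p
auxTasks p q inst (qIdx i) = task (+ 0) (AUXInstance.dq inst i) q

YesInstance : (p q : ℕ) → AUXInstance p q → Set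
YesInstance p q inst =
  Σ (AuxIdx m N → ℚ) λ σ →
    IsFeasibleSchedule (auxTasks p q inst) σ
    × (∀ i → (completion (auxTasks p q inst (pIdx i)) (σ (pIdx i)) ℚ.≤ ⟦ d'p i ⟧ℤ)
           ⊎ (completion (auxTasks p q inst (qIdx i)) (σ (qIdx i)) ℚ.≤ ⟦ d'q i ⟧ℤ))
  where open AUXInstance inst

-- Stacked instance.  t_i = -(p+2q)i + p + q, with i = toℕ k + 1 for k : Fin N.
tpos : (p q : ℕ) {N : ℕ} → Fin N → ℤ
tpos p q k = ℤ.- (+ (p ℕ.+ 2 ℕ.* q) ℤ.* + (suc (toℕ k))) ℤ.+ + (p ℕ.+ q)

data StackIdx (m N : ℕ) : Set where
  jIdx   : Fin m → StackIdx m N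
  sepIdx : Fin N → StackIdx m N
  ipIdx  : Fin N → StackIdx m N
  opIdx  : Fin N → StackIdx m N
  iqIdx  : Fin N → StackIdx m N
  oqIdx  : Fin N → StackIdx m N

stackedTasks : (p q : ℕ) (inst : AUXInstance p q) →
               StackIdx (AUXInstance.m inst) (AUXInstance.N inst) → Task
stackedTasks p q inst (jIdx k)   = AUXInstance.J inst k
stackedTasks p q inst (sepIdx i) = task (tpos p q i) (tpos p q i ℤ.+ + q) q
stackedTasks p q inst (ipIdx i)  = task (tpos p q i ℤ.- + p) (AUXInstance.d'p inst i) p
stackedTasks p q inst (iqIdx i)  = task (tpos p q i ℤ.- + q) (AUXInstance.d'q inst i) q
stackedTasks p q inst (opIdx i)  = task (tpos p q i ℤ.- + p ℤ.- + q) (AUXInstance.dp inst i) p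
stackedTasks p q inst (oqIdx i)  = task (tpos p q i ℤ.- + p ℤ.- + q) (AUXInstance.dq inst i) q

-- The proof is by induction on N.  For N = 0 the stacked instance is J itself.
-- For N > 0 consider the first gap [-p-2q, -q) between J_sep[2] and J_sep[1]:
-- every other task ends before J_sep[1] or starts after it, and the gap, of
-- length p + q, holds at most one p-task, never a p-task with two q-tasks, and
-- of several q-tasks all but one lie in its first p units.  According to which
-- p-task occupies the gap, J_p[1] and J_q[1] become ordinary tasks of J with
-- deadlines (d_p[1], d'_q[1]) or (d'_p[1], d_q[1]), giving a peeled instance of
-- size N - 1.  Its stacked instance is scheduled by reusing the old schedule:
-- tasks after 0 stay, tasks in deeper gaps move down one level by p + 2q, and
-- tasks in the gap take over free slots of level-1 tasks (or the head of the
-- gap is translated onto the slot of J^O_p[1]).  The induction hypothesis then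
-- gives a certificate for the peeled instance, which is one for the original.

module Submission where

open import Defs
open import Data.Nat using (ℕ; _<_; _≤_)
open import Data.Nat as ℕ using (zero; suc)
import Data.Nat.Properties as ℕP
open import Data.Integer as ℤ using (ℤ; +_)
import Data.Integer.Properties as ℤP
import Data.Integer.Solver as ℤS
open import Data.Rational as ℚ using (ℚ; _+_; -_; _-_; 0ℚ) renaming (_≤_ to _≤q_; _<_ to _<q_)
import Data.Rational.Properties as ℚP
import Data.Rational.Unnormalised as ℚᵘ
import Data.Rational.Unnormalised.Properties as ℚᵘP
import Data.Rational.Solver as ℚS
open import Data.Fin using (Fin; zero; suc; toℕ; inject₁)
import Data.Fin.Properties as FinP
open import Data.Sum using (_⊎_; inj₁; inj₂)
open import Function using (case_of_)
open import Data.Product using (Σ; _×_; _,_; proj₁; proj₂)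
open import Data.Empty using (⊥; ⊥-elim)
open import Data.Unit using (⊤; tt)
open import Relation.Nullary using (¬_; Dec; yes; no; _×-dec_; _⊎-dec_)
open import Relation.Binary.PropositionalEquality using (_≡_; _≢_; refl; sym; trans; cong; cong₂; subst; module ≡-Reasoning)

private
  toℚᵘ-⟦⟧ : ∀ z → ℚ.toℚᵘ ⟦ z ⟧ℤ ℚᵘ.≃ ℚᵘ.mkℚᵘ z 0
  toℚᵘ-⟦⟧ z = ℚP.toℚᵘ-fromℚᵘ (ℚᵘ.mkℚᵘ z 0)

⟦⟧-+ : ∀ a b → ⟦ a ℤ.+ b ⟧ℤ ≡ ⟦ a ⟧ℤ + ⟦ b ⟧ℤ
⟦⟧-+ a b = ℚP.toℚᵘ-injective (ℚᵘP.≃-trans (toℚᵘ-⟦⟧ (a ℤ.+ b)) (ℚᵘP.≃-trans unnormalised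
   (ℚᵘP.≃-sym (ℚᵘP.≃-trans (ℚP.toℚᵘ-homo-+ ⟦ a ⟧ℤ ⟦ b ⟧ℤ) (ℚᵘP.+-cong (toℚᵘ-⟦⟧ a) (toℚᵘ-⟦⟧ b))))))
  where
  open ℤS.+-*-Solver
  unnormalised : ℚᵘ.mkℚᵘ (a ℤ.+ b) 0 ℚᵘ.≃ (ℚᵘ.mkℚᵘ a 0 ℚᵘ.+ ℚᵘ.mkℚᵘ b 0)
  unnormalised = ℚᵘ.*≡* (solve 2 (λ x y → (x :+ y) :* con (+ 1) := (x :* con (+ 1) :+ y :* con (+ 1)) :* con (+ 1)) refl a b)

⟦⟧-neg : ∀ a → ⟦ ℤ.- a ⟧ℤ ≡ - ⟦ a ⟧ℤ
⟦⟧-neg a = ℚP.toℚᵘ-injective (ℚᵘP.≃-trans (toℚᵘ-⟦⟧ (ℤ.- a))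
  (ℚᵘP.≃-sym (ℚᵘP.≃-trans (ℚP.toℚᵘ-homo‿- ⟦ a ⟧ℤ) (ℚᵘP.-‿cong (toℚᵘ-⟦⟧ a)))))

⟦⟧-sub : ∀ a b → ⟦ a ℤ.- b ⟧ℤ ≡ ⟦ a ⟧ℤ - ⟦ b ⟧ℤ
⟦⟧-sub a b = trans (⟦⟧-+ a (ℤ.- b)) (cong (λ z → ⟦ a ⟧ℤ + z) (⟦⟧-neg b))

⟦⟧-mono-≤ : ∀ {a b} → a ℤ.≤ b → ⟦ a ⟧ℤ ≤q ⟦ b ⟧ℤ
⟦⟧-mono-≤ {a} {b} a≤b = ℚP.toℚᵘ-cancel-≤ (ℚᵘP.≤-respʳ-≃ (ℚᵘP.≃-sym (toℚᵘ-⟦⟧ b))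
  (ℚᵘP.≤-respˡ-≃ (ℚᵘP.≃-sym (toℚᵘ-⟦⟧ a)) (ℚᵘ.*≤* (ℤP.*-monoʳ-≤-nonNeg (+ 1) a≤b))))

⟦⟧-mono-< : ∀ {a b} → a ℤ.< b → ⟦ a ⟧ℤ <q ⟦ b ⟧ℤ
⟦⟧-mono-< {a} {b} a<b = ℚP.toℚᵘ-cancel-< (ℚᵘP.<-respʳ-≃ (ℚᵘP.≃-sym (toℚᵘ-⟦⟧ b))
  (ℚᵘP.<-respˡ-≃ (ℚᵘP.≃-sym (toℚᵘ-⟦⟧ a)) (ℚᵘ.*<* (ℤP.*-monoʳ-<-pos (+ 1) a<b))))

⟦⟧ℕ-nonneg : ∀ n → 0ℚ ≤q ⟦ n ⟧ℕ
⟦⟧ℕ-nonneg n = ⟦⟧-mono-≤ {+ 0} {+ n} (ℤ.+≤+ ℕ.z≤n)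

-- Chains of inequalities over ℚ; the fixity lets a chain be a component of a pair.
infixr 5 _⟨≤⟩_
_⟨≤⟩_ : ∀ {a b c} → a ≤q b → b ≤q c → a ≤q c
_⟨≤⟩_ = ℚP.≤-trans

≤-cong : ∀ {a a' b b'} → a ≡ a' → b ≡ b' → a ≤q b → a' ≤q b'
≤-cong refl refl h = h

+-monoˡ : ∀ {a b} c → a ≤q b → a + c ≤q b + c
+-monoˡ c = ℚP.+-monoˡ-≤ c

+-cancelˡ : ∀ {a b} c → a + c ≤q b + c → a ≤q b
+-cancelˡ {a} {b} c h = ≤-cong (cancel a) (cancel b) (+-monoˡ (- c) h)
  where
  open ℚS.+-*-Solver
  cancel : ∀ x → (x + c) - c ≡ x
  cancel x = solve 2 (λ x c → x :+ c :- c := x) refl x c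

≤-+-nonneg : ∀ {a} l → 0ℚ ≤q l → a ≤q a + l
≤-+-nonneg {a} l h = ≤-cong (ℚP.+-identityʳ a) refl (ℚP.+-monoʳ-≤ a h)

-- The basic shape of every linear argument below: a sum of inequalities
-- A ≤ B, rearranged, compares x with y.
linear : ∀ {A B} x y → A ≤q B → x + B ≡ y + A → x ≤q y
linear {A} x y h eq = +-cancelˡ A (ℚP.+-monoʳ-≤ x h ⟨≤⟩ ℚP.≤-reflexive eq)

overshoot : ∀ {x y} c → x ≤q y → x ≡ y + c → 0ℚ <q c → ⊥
overshoot {x} {y} c x≤y eq c>0 =
  ℚP.<-irrefl refl (ℚP.<-≤-trans y<y+c (≤-cong eq refl x≤y))
  where
  y<y+c : y <q y + c
  y<y+c = subst (_<q y + c) (ℚP.+-identityʳ y) (ℚP.+-monoʳ-< y c>0)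

ℓ : Task → ℚ
ℓ T = ⟦ len T ⟧ℕ

Within : ℚ → ℚ → ℚ → ℚ → Set
Within g e s l = (g ≤q s) × (s + l ≤q e)

Disjoint : ℚ → ℚ → ℚ → ℚ → Set
Disjoint s l s' l' = (s + l ≤q s') ⊎ (s' + l' ≤q s)

shift-before : ∀ {s l s'} d → s + l ≤q s' → (s + d) + l ≤q s' + d
shift-before {s} {l} d h =
  ≤-cong (solve 3 (λ s l d → s :+ l :+ d := s :+ d :+ l) refl s l d) refl (+-monoˡ d h)
  where open ℚS.+-*-Solver

shift-disjoint : ∀ {s l s' l'} d → Disjoint s l s' l' → Disjoint (s + d) l (s' + d) l'
shift-disjoint {s} {l} {s'} d (inj₁ h) = inj₁ (shift-before {s} {l} {s'} d h)
shift-disjoint {s} {l} {s'} {l'} d (inj₂ h) = inj₂ (shift-before {s'} {l'} {s} d h)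

back-to-back : ∀ {g e s₁ l₁ s₂ l₂} → g ≤q s₁ → s₁ + l₁ ≤q s₂ → s₂ + l₂ ≤q e →
               (g + l₁) + l₂ ≤q e
back-to-back {l₁ = l₁} {l₂ = l₂} g≤s₁ h h₂ = +-monoˡ l₂ (+-monoˡ l₁ g≤s₁ ⟨≤⟩ h) ⟨≤⟩ h₂

exchange : ∀ g a b → (g + a) + b ≡ (g + b) + a
exchange g a b = solve 3 (λ g a b → g :+ a :+ b := g :+ b :+ a) refl g a b
  where open ℚS.+-*-Solver

two-in-window : ∀ {g e s₁ l₁ s₂ l₂} → Within g e s₁ l₁ → Within g e s₂ l₂ →
                Disjoint s₁ l₁ s₂ l₂ → (g + l₁) + l₂ ≤q e
two-in-window (g≤s₁ , _) (_ , s₂≤e) (inj₁ h) = back-to-back g≤s₁ h s₂≤e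
two-in-window {g} {l₁ = l₁} {l₂ = l₂} (_ , s₁≤e) (g≤s₂ , _) (inj₂ h) =
  ≤-cong (exchange g l₂ l₁) refl (back-to-back g≤s₂ h s₁≤e)

-- Three pairwise disjoint intervals inside [g, e] have total length at most
-- e - g: split according to the position of the first interval relative to
-- the other two.
three-in-window : ∀ {g e s₁ l₁ s₂ l₂ s₃ l₃} →
  Within g e s₁ l₁ → Within g e s₂ l₂ → Within g e s₃ l₃ →
  Disjoint s₁ l₁ s₂ l₂ → Disjoint s₁ l₁ s₃ l₃ → Disjoint s₂ l₂ s₃ l₃ →
  ((g + l₁) + l₂) + l₃ ≤q e
three-in-window {g} {e} {s₁} {l₁} {s₂} {l₂} {s₃} {l₃} (g≤s₁ , s₁≤e) (g≤s₂ , s₂≤e) (g≤s₃ , s₃≤e) d₁₂ d₁₃ d₂₃ =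
  by-first d₁₂ d₁₃
  where
  open ℚS.+-*-Solver
  by-first : Disjoint s₁ l₁ s₂ l₂ → Disjoint s₁ l₁ s₃ l₃ → ((g + l₁) + l₂) + l₃ ≤q e
  by-first (inj₁ h₁₂) (inj₁ h₁₃) =
    +-monoˡ l₃ (+-monoˡ l₂ (+-monoˡ l₁ g≤s₁)) ⟨≤⟩ two-in-window (h₁₂ , s₂≤e) (h₁₃ , s₃≤e) d₂₃
  by-first (inj₂ h₂₁) (inj₂ h₃₁) =
    ≤-cong (solve 4 (λ g a b c → g :+ b :+ c :+ a := g :+ a :+ b :+ c) refl g l₁ l₂ l₃) refl
           (+-monoˡ l₁ (two-in-window (g≤s₂ , h₂₁) (g≤s₃ , h₃₁) d₂₃) ⟨≤⟩ s₁≤e)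
  by-first (inj₁ h₁₂) (inj₂ h₃₁) =
    ≤-cong (solve 4 (λ g a b c → g :+ c :+ a :+ b := g :+ a :+ b :+ c) refl g l₁ l₂ l₃) refl
           (+-monoˡ l₂ (back-to-back g≤s₃ h₃₁ h₁₂) ⟨≤⟩ s₂≤e)
  by-first (inj₂ h₂₁) (inj₁ h₁₃) =
    ≤-cong (solve 4 (λ g a b c → g :+ b :+ a :+ c := g :+ a :+ b :+ c) refl g l₁ l₂ l₃) refl
           (+-monoˡ l₃ (back-to-back g≤s₂ h₂₁ h₁₃) ⟨≤⟩ s₃≤e)

-- A schedule is feasible once every task lies in its window and distinct tasks
-- are disjoint; the lengths may be given by any family ℓ' agreeing with the tasks.
feasible-intro : ∀ {I : Set} (T : I → Task) (σ : I → ℚ) (ℓ' : I → ℚ) →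
  (∀ x → ℓ (T x) ≡ ℓ' x) →
  (∀ x → Within ⟦ release (T x) ⟧ℤ ⟦ deadline (T x) ⟧ℤ (σ x) (ℓ' x)) →
  (∀ x y → x ≢ y → Disjoint (σ x) (ℓ' x) (σ y) (ℓ' y)) →
  IsFeasibleSchedule T σ
feasible-intro T σ ℓ' lens win dis =
  (λ x → proj₁ (win x) , by-length x (proj₂ (win x))) , λ x y x≢y → both x y (dis x y x≢y)
  where
  by-length : ∀ x {b} → σ x + ℓ' x ≤q b → σ x + ℓ (T x) ≤q b
  by-length x {b} = subst (λ l → σ x + l ≤q b) (sym (lens x))
  both : ∀ x y → Disjoint (σ x) (ℓ' x) (σ y) (ℓ' y) → Disjoint (σ x) (ℓ (T x)) (σ y) (ℓ (T y))
  both x y (inj₁ h) = inj₁ (by-length x h)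
  both x y (inj₂ h) = inj₂ (by-length y h)

relabel : ∀ {I I' : Set} (T : I → Task) (σ : I → ℚ) → IsFeasibleSchedule T σ →
  (T' : I' → Task) (f : I' → I) → (∀ x y → x ≢ y → f x ≢ f y) →
  (∀ x → len (T' x) ≡ len (T (f x))) →
  (∀ x → Within ⟦ release (T' x) ⟧ℤ ⟦ deadline (T' x) ⟧ℤ (σ (f x)) (ℓ (T (f x)))) →
  IsFeasibleSchedule T' (λ x → σ (f x))
relabel T σ F T' f f-inj lens win =
  feasible-intro T' (λ x → σ (f x)) (λ x → ℓ (T (f x))) (λ x → cong ⟦_⟧ℕ (lens x)) win
    (λ x y x≢y → proj₂ F (f x) (f y) (f-inj x y x≢y))

chain-≤ : ∀ {N} {a' a : Fin N → ℤ} → Chain N a' a →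
          ∀ k (i j : Fin N) → toℕ j ≡ suc (k ℕ.+ toℕ i) → a i ℤ.≤ a' j
chain-≤ C zero i j j≡ = proj₂ C i j j≡
chain-≤ C (suc k) i (suc j) j≡ =
  ℤP.≤-trans (chain-≤ C k i (inject₁ j) below) (ℤP.≤-trans (proj₁ C (inject₁ j)) (proj₂ C (inject₁ j) (suc j) next))
  where
  below : toℕ (inject₁ j) ≡ suc (k ℕ.+ toℕ i)
  below = trans (FinP.toℕ-inject₁ j) (ℕP.suc-injective j≡)
  next : toℕ (suc j) ≡ suc (toℕ (inject₁ j))
  next = cong suc (sym (FinP.toℕ-inject₁ j))

chain-head-≤' : ∀ {n} {a' a : Fin (suc n) → ℤ} → Chain (suc n) a' a → ∀ i → a zero ℤ.≤ a' (suc i)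
chain-head-≤' C i = chain-≤ C (toℕ i) zero (suc i) (cong suc (sym (ℕP.+-identityʳ (toℕ i))))

chain-head-≤ : ∀ {n} {a' a : Fin (suc n) → ℤ} → Chain (suc n) a' a → ∀ i → a zero ℤ.≤ a (suc i)
chain-head-≤ C i = ℤP.≤-trans (chain-head-≤' C i) (proj₁ C (suc i))

chain-tail : ∀ {n} {a' a : Fin (suc n) → ℤ} → Chain (suc n) a' a →
             Chain n (λ i → a' (suc i)) (λ i → a (suc i))
chain-tail C = (λ i → proj₁ C (suc i)) , λ i j j≡ → proj₂ C (suc i) (suc j) (cong suc j≡)

mkAUX : ∀ {p q} (m : ℕ) (J : Fin m → Task) (N : ℕ) (d'p dp d'q dq : Fin N → ℤ) → AUXInstance p q
mkAUX m J N d'p dp d'q dq = record { m = m ; J = J ; N = N ; d'p = d'p ; dp = dp ; d'q = d'q ; dq = dq }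

extendJ : ∀ (p q : ℕ) {m} (ep eq : ℤ) → (Fin m → Task) → Fin (suc (suc m)) → Task
extendJ p q ep eq J zero = task (+ 0) ep p
extendJ p q ep eq J (suc zero) = task (+ 0) eq q
extendJ p q ep eq J (suc (suc k)) = J k

-- The instance of size n obtained by turning J_p[1] and J_q[1] into ordinary
-- tasks of J with deadlines ep and eq.
peel : ∀ {p q} m (J : Fin m → Task) n (d'p dp d'q dq : Fin (suc n) → ℤ) (ep eq : ℤ) → AUXInstance p q
peel {p} {q} m J n d'p dp d'q dq ep eq =
  mkAUX (suc (suc m)) (extendJ p q ep eq J) n (λ i → d'p (suc i)) (λ i → dp (suc i)) (λ i → d'q (suc i)) (λ i → dq (suc i))

peel-valid : ∀ {p q} m (J : Fin m → Task) n (d'p dp d'q dq : Fin (suc n) → ℤ) (ep eq : ℤ) →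
  ValidAUX p q (mkAUX m J (suc n) d'p dp d'q dq) → ValidAUX p q (peel m J n d'p dp d'q dq ep eq)
peel-valid {p} {q} m J n d'p dp d'q dq ep eq (Jv , Cp , Cq , dp≤d'q) =
  newJ , chain-tail Cp , chain-tail Cq , (λ i → dp≤d'q (suc i))
  where
  newJ : ∀ k → (len (extendJ p q ep eq J k) ≡ p ⊎ len (extendJ p q ep eq J k) ≡ q)
             × (+ 0 ℤ.≤ release (extendJ p q ep eq J k))
  newJ zero = inj₁ refl , ℤ.+≤+ ℕ.z≤n
  newJ (suc zero) = inj₂ refl , ℤ.+≤+ ℕ.z≤n
  newJ (suc (suc k)) = Jv k

unpeel : ∀ {m n} → AuxIdx m (suc n) → AuxIdx (suc (suc m)) n
unpeel (jIdx k) = jIdx (suc (suc k))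
unpeel (pIdx zero) = jIdx zero
unpeel (pIdx (suc i)) = pIdx i
unpeel (qIdx zero) = jIdx (suc zero)
unpeel (qIdx (suc i)) = qIdx i

unpeel-injective : ∀ {m n} (x y : AuxIdx m (suc n)) → x ≢ y → unpeel x ≢ unpeel y
unpeel-injective x y x≢y eq = x≢y (trans (sym (repeel-unpeel x)) (trans (cong repeel eq) (repeel-unpeel y)))
  where
  repeel : ∀ {m n} → AuxIdx (suc (suc m)) n → AuxIdx m (suc n)
  repeel (jIdx zero) = pIdx zero
  repeel (jIdx (suc zero)) = qIdx zero
  repeel (jIdx (suc (suc k))) = jIdx k
  repeel (pIdx i) = pIdx (suc i)
  repeel (qIdx i) = qIdx (suc i)
  repeel-unpeel : ∀ {m n} (x : AuxIdx m (suc n)) → repeel (unpeel x) ≡ x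
  repeel-unpeel (jIdx k) = refl
  repeel-unpeel (pIdx zero) = refl
  repeel-unpeel (pIdx (suc i)) = refl
  repeel-unpeel (qIdx zero) = refl
  repeel-unpeel (qIdx (suc i)) = refl

peel-yes : ∀ {p q} m (J : Fin m → Task) n (d'p dp d'q dq : Fin (suc n) → ℤ) (ep eq : ℤ) →
  ep ℤ.≤ dp zero → eq ℤ.≤ dq zero → (ep ≡ d'p zero) ⊎ (eq ≡ d'q zero) →
  YesInstance p q (peel m J n d'p dp d'q dq ep eq) → YesInstance p q (mkAUX m J (suc n) d'p dp d'q dq)
peel-yes {p} {q} m J n d'p dp d'q dq ep eq ep≤ eq≤ tight (τ , Fτ , meets) =
  (λ x → τ (unpeel x)) , relabel T' τ Fτ T unpeel unpeel-injective lens win , meets'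
  where
  T' : AuxIdx (suc (suc m)) n → Task
  T' = auxTasks p q (peel m J n d'p dp d'q dq ep eq)
  T : AuxIdx m (suc n) → Task
  T = auxTasks p q (mkAUX m J (suc n) d'p dp d'q dq)
  lens : ∀ x → len (T x) ≡ len (T' (unpeel x))
  lens (jIdx k) = refl
  lens (pIdx zero) = refl
  lens (pIdx (suc i)) = refl
  lens (qIdx zero) = refl
  lens (qIdx (suc i)) = refl
  relaxed : ∀ y {e} → ⟦ deadline (T' y) ⟧ℤ ≤q ⟦ e ⟧ℤ →
            Within ⟦ release (T' y) ⟧ℤ ⟦ e ⟧ℤ (τ y) (ℓ (T' y))
  relaxed y h = proj₁ (proj₁ Fτ y) , (proj₂ (proj₁ Fτ y) ⟨≤⟩ h)
  win : ∀ x → Within ⟦ release (T x) ⟧ℤ ⟦ deadline (T x) ⟧ℤ (τ (unpeel x)) (ℓ (T' (unpeel x)))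
  win (jIdx k) = proj₁ Fτ (jIdx (suc (suc k)))
  win (pIdx zero) = relaxed (jIdx zero) {dp zero} (⟦⟧-mono-≤ ep≤)
  win (pIdx (suc i)) = proj₁ Fτ (pIdx i)
  win (qIdx zero) = relaxed (jIdx (suc zero)) {dq zero} (⟦⟧-mono-≤ eq≤)
  win (qIdx (suc i)) = proj₁ Fτ (qIdx i)
  meets-first : (ep ≡ d'p zero) ⊎ (eq ≡ d'q zero) →
    (τ (jIdx zero) + ⟦ p ⟧ℕ ≤q ⟦ d'p zero ⟧ℤ) ⊎ (τ (jIdx (suc zero)) + ⟦ q ⟧ℕ ≤q ⟦ d'q zero ⟧ℤ)
  meets-first (inj₁ refl) = inj₁ (proj₂ (proj₁ Fτ (jIdx zero)))
  meets-first (inj₂ refl) = inj₂ (proj₂ (proj₁ Fτ (jIdx (suc zero))))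
  meets' : ∀ i → (τ (unpeel (pIdx i)) + ⟦ p ⟧ℕ ≤q ⟦ d'p i ⟧ℤ) ⊎ (τ (unpeel (qIdx i)) + ⟦ q ⟧ℕ ≤q ⟦ d'q i ⟧ℤ)
  meets' zero = meets-first tight
  meets' (suc i) = meets i

yes-of-empty : ∀ {p q} m (J : Fin m → Task) (d'p dp d'q dq : Fin 0 → ℤ) →
  Feasible (stackedTasks p q (mkAUX m J 0 d'p dp d'q dq)) → YesInstance p q (mkAUX m J 0 d'p dp d'q dq)
yes-of-empty {p} {q} m J d'p dp d'q dq (σ , F) =
  (λ x → σ (embed x)) , relabel (stackedTasks p q I) σ F (auxTasks p q I) embed embed-injective lens win , λ ()
  where
  I : AUXInstance p q
  I = mkAUX m J 0 d'p dp d'q dq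
  embed : AuxIdx m 0 → StackIdx m 0
  embed (jIdx k) = jIdx k
  embed-injective : ∀ x y → x ≢ y → embed x ≢ embed y
  embed-injective (jIdx k) (jIdx .k) k≢k refl = k≢k refl
  lens : ∀ x → len (auxTasks p q I x) ≡ len (stackedTasks p q I (embed x))
  lens (jIdx k) = refl
  win : ∀ x → Within ⟦ release (auxTasks p q I x) ⟧ℤ ⟦ deadline (auxTasks p q I x) ⟧ℤ (σ (embed x)) (ℓ (stackedTasks p q I (embed x)))
  win (jIdx k) = proj₁ F (jIdx k)

-- Index j : ℕ stands for i = j + 1, so
-- t j = t_{j+1}; consecutive separators are D = p + 2q apart, J_sep[1] occupies
-- [-q, 0) and the first gap, between J_sep[2] and J_sep[1], is [-p-2q, -q).

module Positions (p q : ℕ) where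

  P Q D : ℚ
  P = ⟦ p ⟧ℕ
  Q = ⟦ q ⟧ℕ
  D = ⟦ p ℕ.+ 2 ℕ.* q ⟧ℕ

  tℤ : ℕ → ℤ
  tℤ j = ℤ.- (+ (p ℕ.+ 2 ℕ.* q) ℤ.* + suc j) ℤ.+ + (p ℕ.+ q)

  t : ℕ → ℚ
  t j = ⟦ tℤ j ⟧ℤ

  G : ℚ
  G = ((- Q) - P) - Q

  private
    p+2q≡ : p ℕ.+ 2 ℕ.* q ≡ (p ℕ.+ q) ℕ.+ q
    p+2q≡ = trans (cong (λ z → p ℕ.+ (q ℕ.+ z)) (ℕP.+-identityʳ q)) (sym (ℕP.+-assoc p q q))

  D≡ : D ≡ (P + Q) + Q
  D≡ = trans (cong ⟦_⟧ℕ p+2q≡) (trans (⟦⟧-+ (+ (p ℕ.+ q)) (+ q)) (cong (_+ Q) (⟦⟧-+ (+ p) (+ q))))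

  t-step : ∀ j → t (suc j) + D ≡ t j
  t-step j = trans (sym (⟦⟧-+ (tℤ (suc j)) (+ (p ℕ.+ 2 ℕ.* q)))) (cong ⟦_⟧ℤ integral)
    where
    open ℤS.+-*-Solver
    integral : tℤ (suc j) ℤ.+ + (p ℕ.+ 2 ℕ.* q) ≡ tℤ j
    integral = solve 3 (λ A K B → :- (A :* (con (+ 1) :+ K)) :+ B :+ A := :- (A :* K) :+ B) refl
                 (+ (p ℕ.+ 2 ℕ.* q)) (+ suc j) (+ (p ℕ.+ q))

  t-first : t 0 ≡ - Q
  t-first = trans (cong ⟦_⟧ℤ integral) (⟦⟧-neg (+ q))
    where
    open ℤS.+-*-Solver
    integral : tℤ 0 ≡ ℤ.- (+ q)
    integral = trans (cong (λ z → ℤ.- (+ z ℤ.* + 1) ℤ.+ + (p ℕ.+ q)) p+2q≡)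
                     (solve 2 (λ B C → :- ((B :+ C) :* con (+ 1)) :+ B := :- C) refl (+ (p ℕ.+ q)) (+ q))

  t-second : t 1 + Q ≡ G
  t-second = begin
    t 1 + Q                  ≡⟨ cong (_+ Q) (solve 2 (λ x D → x := (x :+ D) :- D) refl (t 1) D) ⟩
    ((t 1 + D) - D) + Q      ≡⟨ cong (λ z → (z - D) + Q) (trans (t-step 0) t-first) ⟩
    ((- Q) - D) + Q          ≡⟨ cong (λ z → ((- Q) - z) + Q) D≡ ⟩
    ((- Q) - ((P + Q) + Q)) + Q ≡⟨ solve 2 (λ P Q → ((:- Q) :- ((P :+ Q) :+ Q)) :+ Q := ((:- Q) :- P) :- Q) refl P Q ⟩
    G                        ∎
    where
    open ≡-Reasoning
    open ℚS.+-*-Solver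

  P≥0 : 0ℚ ≤q P
  P≥0 = ⟦⟧ℕ-nonneg p

  Q≥0 : 0ℚ ≤q Q
  Q≥0 = ⟦⟧ℕ-nonneg q

  t≤-Q : ∀ j → t j ≤q - Q
  t≤-Q zero = ℚP.≤-reflexive t-first
  t≤-Q (suc j) = ≤-+-nonneg D (⟦⟧ℕ-nonneg (p ℕ.+ 2 ℕ.* q)) ⟨≤⟩ ℚP.≤-reflexive (t-step j) ⟨≤⟩ t≤-Q j

  inner-release : ∀ {N} (k : Fin N) l → ⟦ tpos p q k ℤ.- + l ⟧ℤ ≡ t (toℕ k) - ⟦ l ⟧ℕ
  inner-release k l = ⟦⟧-sub (tpos p q k) (+ l)

  outer-release : ∀ {N} (k : Fin N) → ⟦ tpos p q k ℤ.- + p ℤ.- + q ⟧ℤ ≡ (t (toℕ k) - P) - Q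
  outer-release k = trans (⟦⟧-sub (tpos p q k ℤ.- + p) (+ q)) (cong (_- Q) (inner-release k p))

  inner-release-step : ∀ {N} (k : Fin N) l → ⟦ tpos p q k ℤ.- + l ⟧ℤ ≡ ⟦ tpos p q (suc k) ℤ.- + l ⟧ℤ + D
  inner-release-step k l =
    trans (inner-release k l) (trans (sym moved) (cong (_+ D) (sym (inner-release (suc k) l))))
    where
    open ℚS.+-*-Solver
    moved : (t (suc (toℕ k)) - ⟦ l ⟧ℕ) + D ≡ t (toℕ k) - ⟦ l ⟧ℕ
    moved = trans (solve 3 (λ a z D → (a :- z) :+ D := (a :+ D) :- z) refl (t (suc (toℕ k))) ⟦ l ⟧ℕ D)
                  (cong (_- ⟦ l ⟧ℕ) (t-step (toℕ k)))

  outer-release-step : ∀ {N} (k : Fin N) → ⟦ tpos p q k ℤ.- + p ℤ.- + q ⟧ℤ ≡ ⟦ tpos p q (suc k) ℤ.- + p ℤ.- + q ⟧ℤ + D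
  outer-release-step k =
    trans (outer-release k) (trans (sym moved) (cong (_+ D) (sym (outer-release (suc k)))))
    where
    open ℚS.+-*-Solver
    moved : ((t (suc (toℕ k)) - P) - Q) + D ≡ (t (toℕ k) - P) - Q
    moved = trans (solve 4 (λ a P Q D → ((a :- P) :- Q) :+ D := ((a :+ D) :- P) :- Q) refl (t (suc (toℕ k))) P Q D)
                  (cong (λ z → (z - P) - Q) (t-step (toℕ k)))

  inner-release≤0 : ∀ {N} (k : Fin N) l → ⟦ tpos p q k ℤ.- + l ⟧ℤ ≤q 0ℚ
  inner-release≤0 k l = ≤-cong (sym (inner-release k l)) refl
    (linear (t j - z) 0ℚ (ℚP.+-mono-≤ (t≤-Q j) (ℚP.+-mono-≤ Q≥0 (⟦⟧ℕ-nonneg l)))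
      (solve 3 (λ a z Q → (a :- z) :+ (:- Q :+ (Q :+ z)) := con 0ℚ :+ (a :+ con 0ℚ)) refl (t j) z Q))
    where
    open ℚS.+-*-Solver
    j : ℕ
    j = toℕ k
    z : ℚ
    z = ⟦ l ⟧ℕ

  outer-release≤0 : ∀ {N} (k : Fin N) → ⟦ tpos p q k ℤ.- + p ℤ.- + q ⟧ℤ ≤q 0ℚ
  outer-release≤0 k = ≤-cong (sym (outer-release k)) refl
    (linear ((t j - P) - Q) 0ℚ (ℚP.+-mono-≤ (t≤-Q j) (ℚP.+-mono-≤ Q≥0 (ℚP.+-mono-≤ P≥0 Q≥0)))
      (solve 3 (λ a P Q → ((a :- P) :- Q) :+ (:- Q :+ (Q :+ (P :+ Q))) := con 0ℚ :+ (a :+ (con 0ℚ :+ (con 0ℚ :+ con 0ℚ)))) refl (t j) P Q))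
    where
    open ℚS.+-*-Solver
    j : ℕ
    j = toℕ k

  -Q≤0 : - Q ≤q 0ℚ
  -Q≤0 = ℚP.neg-antimono-≤ Q≥0

  G≤-Q-P : G ≤q (- Q) - P
  G≤-Q-P = linear G ((- Q) - P) Q≥0 (solve 2 (λ P Q → ((:- Q :- P) :- Q) :+ Q := ((:- Q) :- P) :+ con 0ℚ) refl P Q)
    where open ℚS.+-*-Solver

  G≤-Q-Q : G ≤q (- Q) - Q
  G≤-Q-Q = linear G ((- Q) - Q) P≥0 (solve 2 (λ P Q → ((:- Q :- P) :- Q) :+ P := ((:- Q) :- Q) :+ con 0ℚ) refl P Q)
    where open ℚS.+-*-Solver

  gap-excludes-pp : Q <q P → (G + P) + P ≤q - Q → ⊥
  gap-excludes-pp Q<P h = overshoot (P - Q) h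
    (solve 2 (λ P Q → (((:- Q :- P) :- Q) :+ P) :+ P := (:- Q) :+ (P :- Q)) refl P Q)
    (subst (_<q P - Q) (ℚP.+-inverseʳ Q) (ℚP.+-monoˡ-< (- Q) Q<P))
    where open ℚS.+-*-Solver

  gap-excludes-pqq : 0ℚ <q Q → ((G + P) + Q) + Q ≤q - Q → ⊥
  gap-excludes-pqq Q>0 h = overshoot Q h
    (solve 2 (λ P Q → ((((:- Q :- P) :- Q) :+ P) :+ Q) :+ Q := (:- Q) :+ Q) refl P Q) Q>0
    where open ℚS.+-*-Solver

  -- a q-task followed by a q-task ending by -Q ends by -2Q, inside the first
  -- P units [G, -2Q) of the gap
  q-before-q : ∀ a b → a + Q ≤q b → b + Q ≤q - Q → a + Q ≤q (- Q) - Q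
  q-before-q a b h₁ h₂ = linear (a + Q) ((- Q) - Q) (ℚP.+-mono-≤ h₁ h₂)
    (solve 3 (λ a b Q → (a :+ Q) :+ (b :+ (:- Q)) := ((:- Q) :- Q) :+ ((a :+ Q) :+ (b :+ Q))) refl a b Q)
    where open ℚS.+-*-Solver

  late-q-not-in-head : 0ℚ <q Q → ∀ a → (- Q) - Q ≤q a → a + Q ≤q (- Q) - Q → ⊥
  late-q-not-in-head Q>0 a h₁ h₂ = overshoot Q (ℚP.+-mono-≤ h₁ h₂)
    (solve 2 (λ Q a → ((:- Q) :- Q) :+ (a :+ Q) := (a :+ ((:- Q) :- Q)) :+ Q) refl Q a) Q>0
    where open ℚS.+-*-Solver

  late-p-late-q-exclusive : 0ℚ <q Q → 0ℚ <q P → ∀ a b → (- Q) - P ≤q a → (- Q) - Q ≤q b →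
    Disjoint a P b Q → a + P ≤q - Q → b + Q ≤q - Q → ⊥
  late-p-late-q-exclusive Q>0 P>0 a b a≥ b≥ (inj₁ h) _ b≤ =
    overshoot Q (ℚP.+-mono-≤ (ℚP.+-mono-≤ a≥ h) b≤)
      (solve 4 (λ P Q a b → (((:- Q) :- P) :+ (a :+ P)) :+ (b :+ Q) := (a :+ b :+ (:- Q)) :+ Q) refl P Q a b) Q>0
    where open ℚS.+-*-Solver
  late-p-late-q-exclusive Q>0 P>0 a b a≥ b≥ (inj₂ h) a≤ _ =
    overshoot P (ℚP.+-mono-≤ (ℚP.+-mono-≤ b≥ h) a≤)
      (solve 4 (λ P Q a b → (((:- Q) :- Q) :+ (b :+ Q)) :+ (a :+ P) := (b :+ a :+ (:- Q)) :+ P) refl P Q a b) P>0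
    where open ℚS.+-*-Solver

  shifted-end : ∀ s l → s + l ≤q t 1 → (s + D) + l ≤q - Q
  shifted-end s l h = linear ((s + D) + l) (- Q) (+-monoˡ D h)
    (trans (solve 4 (λ s l D u → ((s :+ D) :+ l) :+ (u :+ D) := (u :+ D) :+ (s :+ l :+ D)) refl s l D (t 1))
           (cong (λ z → z + ((s + l) + D)) (trans (t-step 0) t-first)))
    where open ℚS.+-*-Solver

  -- Translating by E = o - G maps the head [G, G + P) of the gap onto [o, o + P).
  translate-start : ∀ o s → G ≤q s → o ≤q s + (o - G)
  translate-start o s h = linear o (s + (o - G)) h
    (solve 4 (λ P Q o s → o :+ s := (s :+ (o :- ((:- Q :- P) :- Q))) :+ ((:- Q :- P) :- Q)) refl P Q o s)
    where open ℚS.+-*-Solver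

  translate-end : ∀ o s → s + Q ≤q (- Q) - Q → (s + (o - G)) + Q ≤q o + P
  translate-end o s h = linear ((s + (o - G)) + Q) (o + P) h
    (solve 4 (λ P Q o s → ((s :+ (o :- ((:- Q :- P) :- Q))) :+ Q) :+ ((:- Q) :- Q) := (o :+ P) :+ (s :+ Q)) refl P Q o s)
    where open ℚS.+-*-Solver

-- Given a feasible schedule σ of the stacked instance with
-- N = n + 1 levels, we build a feasible schedule of the stacked instance of the
-- peeled instance (levels 2..N become levels 1..n).

module Reduction (p q : ℕ) (q≥1 : 1 ≤ q) (q<p : q < p) (m : ℕ) (J : Fin m → Task) (n : ℕ)
   (d'p dp d'q dq : Fin (suc n) → ℤ) (V : ValidAUX p q (mkAUX m J (suc n) d'p dp d'q dq))
   (σ : StackIdx m (suc n) → ℚ)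
   (F : IsFeasibleSchedule (stackedTasks p q (mkAUX m J (suc n) d'p dp d'q dq)) σ) where

  open Positions p q

  Old : Set
  Old = StackIdx m (suc n)

  T : Old → Task
  T = stackedTasks p q (mkAUX m J (suc n) d'p dp d'q dq)

  L : Old → ℚ
  L y = ℓ (T y)

  window : ∀ y → Within ⟦ release (T y) ⟧ℤ ⟦ deadline (T y) ⟧ℤ (σ y) (L y)
  window = proj₁ F

  disjoint : ∀ y z → y ≢ z → Disjoint (σ y) (L y) (σ z) (L z)
  disjoint = proj₂ F

  Q>0 : 0ℚ <q Q
  Q>0 = ⟦⟧-mono-< {+ 0} {+ q} (ℤ.+<+ q≥1)

  Q<P : Q <q P
  Q<P = ⟦⟧-mono-< {+ q} {+ p} (ℤ.+<+ q<p)

  P>0 : 0ℚ <q P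
  P>0 = ℚP.<-trans Q>0 Q<P

  p≢q : ∀ u v → L u ≡ P → L v ≡ Q → u ≢ v
  p≢q u v Lu Lv refl = ℚP.<-irrefl (trans (sym Lv) Lu) Q<P

  -- the window of a separator has exactly its length
  separator-fixed : ∀ k → σ (sepIdx k) ≡ t (toℕ k)
  separator-fixed k = ℚP.≤-antisym (+-cancelˡ Q (≤-cong refl (⟦⟧-+ (tpos p q k) (+ q)) (proj₂ (window (sepIdx k)))))
                                   (proj₁ (window (sepIdx k)))

  sep₁ ip₁ op₁ iq₁ oq₁ : Old
  sep₁ = sepIdx zero
  ip₁ = ipIdx zero
  op₁ = opIdx zero
  iq₁ = iqIdx zero
  oq₁ = oqIdx zero

  -- J_sep[2], which exists as soon as there is a second level, i.e. some k : Fin n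
  first : Fin n → Fin n
  first zero = zero
  first (suc _) = zero

  sep₂ : Fin n → Old
  sep₂ k = sepIdx (suc (first k))

  σ-sep₂ : ∀ k → σ (sep₂ k) ≡ t 1
  σ-sep₂ zero = separator-fixed (suc zero)
  σ-sep₂ (suc _) = separator-fixed (suc zero)

  EndsBefore StartsAfter InGap InHead : Old → Set
  EndsBefore y = σ y + L y ≤q - Q
  StartsAfter y = 0ℚ ≤q σ y
  InGap y = EndsBefore y × (G ≤q σ y)
  -- a q-task y ends within the head [G, G + P) of the gap
  InHead y = σ y + Q ≤q (- Q) - Q

  InGap? : ∀ y → Dec (InGap y)
  InGap? y = (σ y + L y ℚP.≤? - Q) ×-dec (G ℚP.≤? σ y)

  InHead? : ∀ y → Dec (InHead y)
  InHead? y = σ y + Q ℚP.≤? (- Q) - Q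

  σ-sep₁ : σ sep₁ ≡ - Q
  σ-sep₁ = trans (separator-fixed zero) t-first

  before-or-after : ∀ y → y ≢ sep₁ → EndsBefore y ⊎ StartsAfter y
  before-or-after y y≢sep₁ = case disjoint y sep₁ y≢sep₁ of λ where
    (inj₁ h) → inj₁ (≤-cong refl σ-sep₁ h)
    (inj₂ h) → inj₂ (≤-cong (trans (cong (_+ Q) σ-sep₁) (ℚP.+-inverseˡ Q)) refl h)

  gap-or-after : ∀ y → y ≢ sep₁ → G ≤q σ y → InGap y ⊎ StartsAfter y
  gap-or-after y y≢sep₁ G≤σy = case before-or-after y y≢sep₁ of λ where
    (inj₁ h) → inj₁ (h , G≤σy)
    (inj₂ h) → inj₂ h

  ip₁-start : (- Q) - P ≤q σ ip₁
  ip₁-start = ≤-cong (trans (inner-release {suc n} zero p) (cong (_- P) t-first)) refl (proj₁ (window ip₁))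

  iq₁-start : (- Q) - Q ≤q σ iq₁
  iq₁-start = ≤-cong (trans (inner-release {suc n} zero q) (cong (_- Q) t-first)) refl (proj₁ (window iq₁))

  outer₁-start : ∀ {y} → ⟦ release (T y) ⟧ℤ ≡ ⟦ tpos p q {suc n} zero ℤ.- + p ℤ.- + q ⟧ℤ → G ≤q σ y
  outer₁-start {y} rel = ≤-cong (trans rel (trans (outer-release {suc n} zero) (cong (λ z → (z - P) - Q) t-first)))
                                refl (proj₁ (window y))

  ip₁-position : InGap ip₁ ⊎ StartsAfter ip₁
  ip₁-position = gap-or-after ip₁ (λ ()) (G≤-Q-P ⟨≤⟩ ip₁-start)

  iq₁-position : InGap iq₁ ⊎ StartsAfter iq₁
  iq₁-position = gap-or-after iq₁ (λ ()) (G≤-Q-Q ⟨≤⟩ iq₁-start)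

  op₁-position : InGap op₁ ⊎ StartsAfter op₁
  op₁-position = gap-or-after op₁ (λ ()) (outer₁-start {op₁} refl)

  oq₁-position : InGap oq₁ ⊎ StartsAfter oq₁
  oq₁-position = gap-or-after oq₁ (λ ()) (outer₁-start {oq₁} refl)

  no-two-p-in-gap : ∀ u v → u ≢ v → L u ≡ P → L v ≡ P → InGap u → InGap v → ⊥
  no-two-p-in-gap u v u≢v Lu Lv (u-end , u-start) (v-end , v-start) =
    gap-excludes-pp Q<P (≤-cong (cong₂ (λ x y → (G + x) + y) Lu Lv) refl
      (two-in-window (u-start , u-end) (v-start , v-end) (disjoint u v u≢v)))

  no-pqq-in-gap : ∀ u x y → x ≢ y → u ≢ x → u ≢ y → L u ≡ P → L x ≡ Q → L y ≡ Q →
                  InGap u → InGap x → InGap y → ⊥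
  no-pqq-in-gap u x y x≢y u≢x u≢y Lu Lx Ly (u-end , u-start) (x-end , x-start) (y-end , y-start) =
    gap-excludes-pqq Q>0 (≤-cong (cong₂ _+_ (cong₂ (λ a b → (G + a) + b) Lu Lx) Ly) refl
      (three-in-window (u-start , u-end) (x-start , x-end) (y-start , y-end)
                       (disjoint u x u≢x) (disjoint u y u≢y) (disjoint x y x≢y)))

  no-two-late-q-in-gap : ∀ x y → x ≢ y → L x ≡ Q → L y ≡ Q → InGap x → InGap y →
                         ¬ InHead x → ¬ InHead y → ⊥
  no-two-late-q-in-gap x y x≢y Lx Ly (x-end , _) (y-end , _) x-late y-late = case disjoint x y x≢y of λ where
    (inj₁ h) → x-late (q-before-q (σ x) (σ y) (subst (λ l → σ x + l ≤q σ y) Lx h) (subst (λ l → σ y + l ≤q - Q) Ly y-end))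
    (inj₂ h) → y-late (q-before-q (σ y) (σ x) (subst (λ l → σ y + l ≤q σ x) Ly h) (subst (λ l → σ x + l ≤q - Q) Lx x-end))

  -- J^I_p[1] and J^I_q[1] are released too late to share the gap
  not-both-inner₁-in-gap : InGap ip₁ → InGap iq₁ → ⊥
  not-both-inner₁-in-gap (ip-end , _) (iq-end , _) =
    late-p-late-q-exclusive Q>0 P>0 (σ ip₁) (σ iq₁) ip₁-start iq₁-start (disjoint ip₁ iq₁ (λ ())) ip-end iq-end

  -- J^I_q[1] is released too late to end in the head of the gap
  iq₁-not-in-head : ¬ InHead iq₁
  iq₁-not-in-head = late-q-not-in-head Q>0 (σ iq₁) iq₁-start

  -- A task of level at least 2 is after J_sep[1], in the gap, or in a deeper
  -- gap; in the last case moving it down by D keeps it before J_sep[1].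
  data Placement (y : Old) : Set where
    is-after : StartsAfter y → Placement y
    is-deep : (σ y + D) + L y ≤q - Q → Placement y
    is-in-gap : InGap y → Placement y

  placement : ∀ k y → y ≢ sep₁ → y ≢ sep₂ k → Placement y
  placement k y y≢sep₁ y≢sep₂ = case before-or-after y y≢sep₁ of λ where
    (inj₂ h) → is-after h
    (inj₁ h) → case G ℚP.≤? σ y of λ where
      (yes G≤σy) → is-in-gap (h , G≤σy)
      (no G≰σy) → case disjoint y (sep₂ k) y≢sep₂ of λ where
        (inj₁ h') → is-deep (shifted-end (σ y) (L y) (≤-cong refl (σ-sep₂ k) h'))
        (inj₂ h') → ⊥-elim (G≰σy (≤-cong (trans (cong (_+ Q) (σ-sep₂ k)) t-second) refl h'))

  J-valid : ∀ k → (len (J k) ≡ p ⊎ len (J k) ≡ q) × (+ 0 ℤ.≤ release (J k))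
  J-valid = proj₁ V

  chain-p : Chain (suc n) d'p dp
  chain-p = proj₁ (proj₂ V)

  chain-q : Chain (suc n) d'q dq
  chain-q = proj₁ (proj₂ (proj₂ V))

  d'p₁≤dp₁ : ⟦ d'p zero ⟧ℤ ≤q ⟦ dp zero ⟧ℤ
  d'p₁≤dp₁ = ⟦⟧-mono-≤ (proj₁ chain-p zero)

  dp₁≤d'q₁ : ⟦ dp zero ⟧ℤ ≤q ⟦ d'q zero ⟧ℤ
  dp₁≤d'q₁ = ⟦⟧-mono-≤ (proj₂ (proj₂ (proj₂ V)) zero)

  d'q₁≤dq₁ : ⟦ d'q zero ⟧ℤ ≤q ⟦ dq zero ⟧ℤ
  d'q₁≤dq₁ = ⟦⟧-mono-≤ (proj₁ chain-q zero)

  dp₁≤dq₁ : ⟦ dp zero ⟧ℤ ≤q ⟦ dq zero ⟧ℤ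
  dp₁≤dq₁ = dp₁≤d'q₁ ⟨≤⟩ d'q₁≤dq₁

  -- d_p[1] ≥ 0: one of J^I_p[1], J^O_p[1] runs after J_sep[1] (they cannot
  -- share the gap) and finishes by d_p[1].
  dp₁≥0 : 0ℚ ≤q ⟦ dp zero ⟧ℤ
  dp₁≥0 = from-positions ip₁-position op₁-position
    where
    from-positions : InGap ip₁ ⊎ StartsAfter ip₁ → InGap op₁ ⊎ StartsAfter op₁ → 0ℚ ≤q ⟦ dp zero ⟧ℤ
    from-positions (inj₂ after-ip) _ = ≤-+-nonneg P P≥0 ⟨≤⟩ +-monoˡ P after-ip ⟨≤⟩ proj₂ (window ip₁) ⟨≤⟩ d'p₁≤dp₁
    from-positions (inj₁ _) (inj₂ after-op) = ≤-+-nonneg P P≥0 ⟨≤⟩ +-monoˡ P after-op ⟨≤⟩ proj₂ (window op₁)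
    from-positions (inj₁ ip-in) (inj₁ op-in) = ⊥-elim (no-two-p-in-gap ip₁ op₁ (λ ()) refl refl ip-in op-in)

  OtherPInGap : Set
  OtherPInGap = InGap op₁ ⊎ Σ (Fin n) (λ i → InGap (ipIdx (suc i)) ⊎ InGap (opIdx (suc i)))

  -- The three shapes of the gap, which determine the deadlines of the two
  -- tasks that replace J_p[1] and J_q[1].
  data GapCase : Set where
    -- J^I_p[1] is in the gap: J_q[1] will meet its tight deadline d'_q[1]
    inner-p-in-gap : InGap ip₁ → GapCase
    -- J^I_p[1] is free for J_p[1], which meets d'_p[1]; another p-task is in the gap
    other-p-in-gap : StartsAfter ip₁ → OtherPInGap → GapCase
    only-q-in-gap : StartsAfter ip₁ → StartsAfter op₁ →
                    (∀ i → ¬ InGap (ipIdx (suc i))) → (∀ i → ¬ InGap (opIdx (suc i))) → GapCase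

  gap-case : GapCase
  gap-case = case ip₁-position of λ where
    (inj₁ ip-in) → inner-p-in-gap ip-in
    (inj₂ after-ip) → case op₁-position of λ where
      (inj₁ op-in) → other-p-in-gap after-ip (inj₁ op-in)
      (inj₂ after-op) → case FinP.any? (λ i → InGap? (ipIdx (suc i)) ⊎-dec InGap? (opIdx (suc i))) of λ where
        (yes deeper-in) → other-p-in-gap after-ip (inj₂ deeper-in)
        (no no-deeper) → only-q-in-gap after-ip after-op (λ i g → no-deeper (i , inj₁ g)) (λ i g → no-deeper (i , inj₂ g))

  gap-p : OtherPInGap → Old
  gap-p (inj₁ _) = op₁
  gap-p (inj₂ (i , inj₁ _)) = ipIdx (suc i)
  gap-p (inj₂ (i , inj₂ _)) = opIdx (suc i)

  gap-p-length : ∀ w → L (gap-p w) ≡ P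
  gap-p-length (inj₁ _) = refl
  gap-p-length (inj₂ (i , inj₁ _)) = refl
  gap-p-length (inj₂ (i , inj₂ _)) = refl

  gap-p-in-gap : ∀ w → InGap (gap-p w)
  gap-p-in-gap (inj₁ g) = g
  gap-p-in-gap (inj₂ (i , inj₁ g)) = g
  gap-p-in-gap (inj₂ (i , inj₂ g)) = g

  ep eq : GapCase → ℤ
  ep (inner-p-in-gap _) = dp zero
  ep _ = d'p zero
  eq (inner-p-in-gap _) = d'q zero
  eq _ = dq zero

  ep≤dp₁ : ∀ C → ep C ℤ.≤ dp zero
  ep≤dp₁ (inner-p-in-gap _) = ℤP.≤-refl
  ep≤dp₁ (other-p-in-gap _ _) = proj₁ chain-p zero
  ep≤dp₁ (only-q-in-gap _ _ _ _) = proj₁ chain-p zero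

  eq≤dq₁ : ∀ C → eq C ℤ.≤ dq zero
  eq≤dq₁ (inner-p-in-gap _) = proj₁ chain-q zero
  eq≤dq₁ (other-p-in-gap _ _) = ℤP.≤-refl
  eq≤dq₁ (only-q-in-gap _ _ _ _) = ℤP.≤-refl

  tight : ∀ C → (ep C ≡ d'p zero) ⊎ (eq C ≡ d'q zero)
  tight (inner-p-in-gap _) = inj₂ refl
  tight (other-p-in-gap _ _) = inj₁ refl
  tight (only-q-in-gap _ _ _ _) = inj₁ refl

  New : Set
  New = StackIdx (suc (suc m)) n

  T' : GapCase → New → Task
  T' C = stackedTasks p q (peel m J n d'p dp d'q dq (ep C) (eq C))

  -- The old task a new task stems from: level i + 1 of the new instance is
  -- level i + 2 of the old one, and the two added tasks stem from J^I_p[1], J^I_q[1].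
  lift : New → Old
  lift (jIdx zero) = ip₁
  lift (jIdx (suc zero)) = iq₁
  lift (jIdx (suc (suc k))) = jIdx k
  lift (sepIdx k) = sepIdx (suc k)
  lift (ipIdx k) = ipIdx (suc k)
  lift (opIdx k) = opIdx (suc k)
  lift (iqIdx k) = iqIdx (suc k)
  lift (oqIdx k) = oqIdx (suc k)

  lift-injective : ∀ {x y} → x ≢ y → lift x ≢ lift y
  lift-injective {x} {y} x≢y eq = x≢y (trans (sym (lower-lift x)) (trans (cong lower eq) (lower-lift y)))
    where
    lower : Old → New
    lower (jIdx k) = jIdx (suc (suc k))
    lower (sepIdx zero) = jIdx zero
    lower (sepIdx (suc k)) = sepIdx k
    lower (ipIdx zero) = jIdx zero
    lower (ipIdx (suc k)) = ipIdx k
    lower (opIdx zero) = jIdx zero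
    lower (opIdx (suc k)) = opIdx k
    lower (iqIdx zero) = jIdx (suc zero)
    lower (iqIdx (suc k)) = iqIdx k
    lower (oqIdx zero) = jIdx zero
    lower (oqIdx (suc k)) = oqIdx k
    lower-lift : ∀ x → lower (lift x) ≡ x
    lower-lift (jIdx zero) = refl
    lower-lift (jIdx (suc zero)) = refl
    lower-lift (jIdx (suc (suc k))) = refl
    lower-lift (sepIdx k) = refl
    lower-lift (ipIdx k) = refl
    lower-lift (opIdx k) = refl
    lower-lift (iqIdx k) = refl
    lower-lift (oqIdx k) = refl

  oq₁≢lift : ∀ y → oq₁ ≢ lift y
  oq₁≢lift (jIdx zero) ()
  oq₁≢lift (jIdx (suc zero)) ()
  oq₁≢lift (jIdx (suc (suc k))) ()
  oq₁≢lift (sepIdx k) ()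
  oq₁≢lift (ipIdx k) ()
  oq₁≢lift (opIdx k) ()
  oq₁≢lift (iqIdx k) ()
  oq₁≢lift (oqIdx k) ()

  -- the four tasks J^I_p[1], J^O_p[1], J^I_q[1], J^O_q[1], whose slots are reused
  Level₁ : Old → Set
  Level₁ (ipIdx zero) = ⊤
  Level₁ (opIdx zero) = ⊤
  Level₁ (iqIdx zero) = ⊤
  Level₁ (oqIdx zero) = ⊤
  Level₁ _ = ⊥

  Level₁≢ : ∀ {u v} → Level₁ u → ¬ Level₁ v → u ≢ v
  Level₁≢ u₁ ¬v₁ refl = ¬v₁ u₁

  -- A new task is run in the slot of an old task y, either
  --   kept:       at σ y, when y starts after J_sep[1];
  --   shifted:    at σ y + D, when y ends by t_2, i.e. moved down one level;
  --   translated: at σ y + E, moving the head [G, G + P) of the gap onto the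
  --               slot [σ op₁, σ op₁ + P) of J^O_p[1].
  data Kind : Set where
    kept shifted translated : Kind

  E : ℚ
  E = σ op₁ - G

  at : Kind → Old → ℚ
  at kept y = σ y
  at shifted y = σ y + D
  at translated y = σ y + E

  Fits : Kind → Old → Set
  Fits kept y = StartsAfter y
  Fits shifted y = (σ y + D) + L y ≤q 0ℚ
  Fits translated y = StartsAfter op₁ × (σ op₁ ≤q σ y + E) × ((σ y + E) + L y ≤q σ op₁ + L op₁)

  -- Slots of distinct old tasks stay disjoint, except that a translated task may
  -- meet a kept J^O_p[1], whose slot it reuses.
  slots-disjoint : ∀ κ κ' a b → Fits κ a → Fits κ' b → a ≢ b →
    (κ ≡ translated → κ' ≡ kept → b ≢ op₁) → (κ' ≡ translated → κ ≡ kept → a ≢ op₁) →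
    Disjoint (at κ a) (L a) (at κ' b) (L b)
  slots-disjoint kept kept a b _ _ a≢b _ _ = disjoint a b a≢b
  slots-disjoint shifted shifted a b _ _ a≢b _ _ = shift-disjoint D (disjoint a b a≢b)
  slots-disjoint translated translated a b _ _ a≢b _ _ = shift-disjoint E (disjoint a b a≢b)
  slots-disjoint kept shifted a b fa fb _ _ _ = inj₂ (fb ⟨≤⟩ fa)
  slots-disjoint shifted kept a b fa fb _ _ _ = inj₁ (fa ⟨≤⟩ fb)
  slots-disjoint shifted translated a b fa (f₀ , f₁ , _) _ _ _ = inj₁ (fa ⟨≤⟩ f₀ ⟨≤⟩ f₁)
  slots-disjoint translated shifted a b (f₀ , f₁ , _) fb _ _ _ = inj₂ (fb ⟨≤⟩ f₀ ⟨≤⟩ f₁)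
  slots-disjoint kept translated a b _ (_ , f₁ , f₂) _ _ a≢op₁ = case disjoint a op₁ (a≢op₁ refl refl) of λ where
    (inj₁ h) → inj₁ (h ⟨≤⟩ f₁)
    (inj₂ h) → inj₂ (f₂ ⟨≤⟩ h)
  slots-disjoint translated kept a b (_ , f₁ , f₂) _ _ b≢op₁ _ = case disjoint b op₁ (b≢op₁ refl refl) of λ where
    (inj₁ h) → inj₂ (h ⟨≤⟩ f₁)
    (inj₂ h) → inj₁ (f₂ ⟨≤⟩ h)

  Xp Xq : New
  Xp = jIdx zero
  Xq = jIdx (suc zero)

  -- The replacement of J_p[1] takes
  -- J^O_p[1]'s slot if J^I_p[1] is in the gap and J^I_p[1]'s otherwise; the
  -- replacement of J_q[1] takes J^O_q[1]'s or J^I_q[1]'s slot; a task of a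
  -- deeper level lying in the gap takes a free level-1 slot of its length.
  Xp-slot q-slot : GapCase → Old
  Xp-slot (inner-p-in-gap _) = op₁
  Xp-slot _ = ip₁
  q-slot (inner-p-in-gap _) = oq₁
  q-slot _ = iq₁

  -- side conditions under which the slots are taken, ensuring no slot is taken twice
  XqToOuter XqToInner PToOuter OnlyQ : GapCase → Set
  XqToOuter (inner-p-in-gap _) = ⊥
  XqToOuter _ = ⊤
  XqToInner (inner-p-in-gap _) = ⊤
  XqToInner (other-p-in-gap _ _) = InGap oq₁
  XqToInner (only-q-in-gap _ _ _ _) = InGap oq₁ × ¬ InHead oq₁
  PToOuter (other-p-in-gap _ _) = ⊤
  PToOuter _ = ⊥
  OnlyQ (only-q-in-gap _ _ _ _) = ⊤
  OnlyQ _ = ⊥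

  QToSlot : GapCase → Old → Set
  QToSlot (only-q-in-gap _ _ _ _) y = ¬ InHead y
  QToSlot _ y = ⊤

  data Takes (C : GapCase) : New → Old → Set where
    Xp-takes : Takes C Xp (Xp-slot C)
    Xq-takes-outer : XqToOuter C → Takes C Xq oq₁
    Xq-takes-inner : XqToInner C → Takes C Xq iq₁
    p-takes : ∀ {x} → InGap (lift x) → L (lift x) ≡ P → PToOuter C → Takes C x op₁
    q-takes : ∀ {x} → InGap (lift x) → L (lift x) ≡ Q → QToSlot C (lift x) → Takes C x (q-slot C)

  q-with-gap-p : ∀ w u v → u ≢ v → L u ≡ Q → L v ≡ Q → InGap u → InGap v → ⊥
  q-with-gap-p w u v u≢v Lu Lv u-in v-in =
    no-pqq-in-gap (gap-p w) u v u≢v (p≢q (gap-p w) u (gap-p-length w) Lu) (p≢q (gap-p w) v (gap-p-length w) Lv)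
                  (gap-p-length w) Lu Lv (gap-p-in-gap w) u-in v-in

  -- No slot is taken by two tasks: otherwise the gap would hold two p-tasks,
  -- a p-task and two q-tasks, or two q-tasks outside its head.
  takes-unique : ∀ C {x y r} → x ≢ y → Takes C x r → Takes C y r → ⊥
  takes-unique (inner-p-in-gap _) x≢y Xp-takes Xp-takes = x≢y refl
  takes-unique (inner-p-in-gap _) x≢y Xp-takes (p-takes _ _ ())
  takes-unique (inner-p-in-gap _) x≢y (p-takes _ _ ()) _
  takes-unique (inner-p-in-gap _) x≢y (Xq-takes-outer ()) _
  takes-unique (inner-p-in-gap _) x≢y (Xq-takes-inner _) (Xq-takes-inner _) = x≢y refl
  takes-unique (inner-p-in-gap ip-in) {x} {y} x≢y (q-takes x-in Lx _) (q-takes y-in Ly _) =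
    no-pqq-in-gap ip₁ (lift x) (lift y) (lift-injective x≢y) (p≢q ip₁ (lift x) refl Lx) (p≢q ip₁ (lift y) refl Ly)
                  refl Lx Ly ip-in x-in y-in
  takes-unique (other-p-in-gap _ _) x≢y Xp-takes Xp-takes = x≢y refl
  takes-unique (other-p-in-gap _ _) x≢y (Xq-takes-outer _) (Xq-takes-outer _) = x≢y refl
  takes-unique (other-p-in-gap _ _) x≢y (Xq-takes-inner _) (Xq-takes-inner _) = x≢y refl
  takes-unique (other-p-in-gap _ _) {x} {y} x≢y (p-takes x-in Lx _) (p-takes y-in Ly _) =
    no-two-p-in-gap (lift x) (lift y) (lift-injective x≢y) Lx Ly x-in y-in
  takes-unique (other-p-in-gap _ w) {y = y} x≢y (Xq-takes-inner oq-in) (q-takes y-in Ly _) =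
    q-with-gap-p w oq₁ (lift y) (oq₁≢lift y) refl Ly oq-in y-in
  takes-unique (other-p-in-gap _ w) {x = x} x≢y (q-takes x-in Lx _) (Xq-takes-inner oq-in) =
    q-with-gap-p w oq₁ (lift x) (oq₁≢lift x) refl Lx oq-in x-in
  takes-unique (other-p-in-gap _ w) {x} {y} x≢y (q-takes x-in Lx _) (q-takes y-in Ly _) =
    q-with-gap-p w (lift x) (lift y) (lift-injective x≢y) Lx Ly x-in y-in
  takes-unique (only-q-in-gap _ _ _ _) x≢y Xp-takes Xp-takes = x≢y refl
  takes-unique (only-q-in-gap _ _ _ _) x≢y (Xq-takes-outer _) (Xq-takes-outer _) = x≢y refl
  takes-unique (only-q-in-gap _ _ _ _) x≢y (Xq-takes-inner _) (Xq-takes-inner _) = x≢y refl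
  takes-unique (only-q-in-gap _ _ _ _) x≢y (p-takes _ _ ()) _
  takes-unique (only-q-in-gap _ _ _ _) {y = y} x≢y (Xq-takes-inner (oq-in , oq-late)) (q-takes y-in Ly y-late) =
    no-two-late-q-in-gap oq₁ (lift y) (oq₁≢lift y) refl Ly oq-in y-in oq-late y-late
  takes-unique (only-q-in-gap _ _ _ _) {x = x} x≢y (q-takes x-in Lx x-late) (Xq-takes-inner (oq-in , oq-late)) =
    no-two-late-q-in-gap oq₁ (lift x) (oq₁≢lift x) refl Lx oq-in x-in oq-late x-late
  takes-unique (only-q-in-gap _ _ _ _) {x} {y} x≢y (q-takes x-in Lx x-late) (q-takes y-in Ly y-late) =
    no-two-late-q-in-gap (lift x) (lift y) (lift-injective x≢y) Lx Ly x-in y-in x-late y-late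

  takes-level₁ : ∀ C {x r} → Takes C x r → Level₁ r
  takes-level₁ (inner-p-in-gap _) Xp-takes = tt
  takes-level₁ (other-p-in-gap _ _) Xp-takes = tt
  takes-level₁ (only-q-in-gap _ _ _ _) Xp-takes = tt
  takes-level₁ C (Xq-takes-outer _) = tt
  takes-level₁ C (Xq-takes-inner _) = tt
  takes-level₁ C (p-takes _ _ _) = tt
  takes-level₁ (inner-p-in-gap _) (q-takes _ _ _) = tt
  takes-level₁ (other-p-in-gap _ _) (q-takes _ _ _) = tt
  takes-level₁ (only-q-in-gap _ _ _ _) (q-takes _ _ _) = tt

  -- when the gap holds only q-tasks, the slot of J^O_p[1] is left to the translated tasks
  takes-not-op₁ : ∀ C {x r} → OnlyQ C → Takes C x r → r ≢ op₁
  takes-not-op₁ (only-q-in-gap _ _ _ _) _ Xp-takes ()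
  takes-not-op₁ (only-q-in-gap _ _ _ _) _ (Xq-takes-outer _) ()
  takes-not-op₁ (only-q-in-gap _ _ _ _) _ (Xq-takes-inner _) ()
  takes-not-op₁ (only-q-in-gap _ _ _ _) _ (p-takes _ _ ())
  takes-not-op₁ (only-q-in-gap _ _ _ _) _ (q-takes _ _ _) ()

  -- Where a new task runs: in the slot of an old task, reused in one of the
  -- three ways, within its new window; the origin records why no other new
  -- task uses the same old slot.
  record Target (C : GapCase) (x : New) : Set where
    constructor target
    field
      slot : Old
      kind : Kind
      same-length : len (T' C x) ≡ len (T slot)
      fits : Fits kind slot
      in-window : Within ⟦ release (T' C x) ⟧ℤ ⟦ deadline (T' C x) ⟧ℤ (at kind slot) (L slot)
      origin : ((slot ≡ lift x) × ¬ Level₁ slot) ⊎ Takes C x slot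
      translated-only-q : kind ≡ translated → OnlyQ C

  take-slot : ∀ C x y → len (T' C x) ≡ len (T y) → StartsAfter y →
    ⟦ release (T' C x) ⟧ℤ ≤q 0ℚ → ⟦ deadline (T y) ⟧ℤ ≤q ⟦ deadline (T' C x) ⟧ℤ →
    Takes C x y → Target C x
  take-slot C x y lens starts-after rel≤0 dl takes =
    target y kept lens starts-after (rel≤0 ⟨≤⟩ starts-after , (proj₂ (window y) ⟨≤⟩ dl)) (inj₂ takes) (λ ())

  translate-slot : ∀ C x y → len (T' C x) ≡ len (T y) → OnlyQ C → StartsAfter op₁ →
    InGap y → InHead y → L y ≡ Q →
    ⟦ release (T' C x) ⟧ℤ ≤q 0ℚ → ⟦ dp zero ⟧ℤ ≤q ⟦ deadline (T' C x) ⟧ℤ →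
    ((y ≡ lift x) × ¬ Level₁ y) ⊎ Takes C x y → Target C x
  translate-slot C x y lens only-q after-op (_ , G≤σy) head Ly rel≤0 dl origin =
    target y translated lens fits (rel≤0 ⟨≤⟩ after-op ⟨≤⟩ start , (end ⟨≤⟩ proj₂ (window op₁) ⟨≤⟩ dl))
           origin (λ _ → only-q)
    where
    start : σ op₁ ≤q σ y + E
    start = translate-start (σ op₁) (σ y) G≤σy
    end : (σ y + E) + L y ≤q σ op₁ + L op₁
    end = ≤-cong (cong (λ l → (σ y + E) + l) (sym Ly)) refl (translate-end (σ op₁) (σ y) head)
    fits : Fits translated y
    fits = after-op , start , end

  -- the tasks of J keep their slots: they start after 0
  J-target : ∀ C k → Target C (jIdx (suc (suc k)))
  J-target C k = target (jIdx k) kept refl released (window (jIdx k)) (inj₁ (refl , λ ())) (λ ())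
    where
    released : StartsAfter (jIdx k)
    released = ⟦⟧-mono-≤ (proj₂ (J-valid k)) ⟨≤⟩ proj₁ (window (jIdx k))

  sep-target : ∀ C k → Target C (sepIdx k)
  sep-target C k = target (sepIdx (suc k)) shifted refl fits
      (ℚP.≤-reflexive (sym moved) , ℚP.≤-reflexive (trans (cong (_+ Q) moved) (sym (⟦⟧-+ (tpos p q k) (+ q)))))
      (inj₁ (refl , λ ())) (λ ())
    where
    moved : σ (sepIdx (suc k)) + D ≡ t (toℕ k)
    moved = trans (cong (_+ D) (separator-fixed (suc k))) (t-step (toℕ k))
    fits : (σ (sepIdx (suc k)) + D) + Q ≤q 0ℚ
    fits = ≤-cong (cong (_+ Q) (sym moved)) (ℚP.+-inverseˡ Q) (+-monoˡ Q (t≤-Q (toℕ k)))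

  Xp-target : ∀ C → Target C Xp
  Xp-target C@(inner-p-in-gap ip-in) = case op₁-position of λ where
    (inj₁ op-in) → ⊥-elim (no-two-p-in-gap ip₁ op₁ (λ ()) refl refl ip-in op-in)
    (inj₂ after-op) → take-slot C Xp op₁ refl after-op ℚP.≤-refl ℚP.≤-refl Xp-takes
  Xp-target C@(other-p-in-gap after-ip _) = take-slot C Xp ip₁ refl after-ip ℚP.≤-refl ℚP.≤-refl Xp-takes
  Xp-target C@(only-q-in-gap after-ip _ _ _) = take-slot C Xp ip₁ refl after-ip ℚP.≤-refl ℚP.≤-refl Xp-takes

  Xq-target : ∀ C → Target C Xq
  Xq-target C@(inner-p-in-gap ip-in) = case iq₁-position of λ where
    (inj₁ iq-in) → ⊥-elim (not-both-inner₁-in-gap ip-in iq-in)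
    (inj₂ after-iq) → take-slot C Xq iq₁ refl after-iq ℚP.≤-refl ℚP.≤-refl (Xq-takes-inner tt)
  Xq-target C@(other-p-in-gap _ w) = case oq₁-position of λ where
    (inj₂ after-oq) → take-slot C Xq oq₁ refl after-oq ℚP.≤-refl ℚP.≤-refl (Xq-takes-outer tt)
    (inj₁ oq-in) → case iq₁-position of λ where
      (inj₁ iq-in) → ⊥-elim (q-with-gap-p w iq₁ oq₁ (λ ()) refl refl iq-in oq-in)
      (inj₂ after-iq) → take-slot C Xq iq₁ refl after-iq ℚP.≤-refl d'q₁≤dq₁ (Xq-takes-inner oq-in)
  Xq-target C@(only-q-in-gap _ after-op _ _) = case oq₁-position of λ where
    (inj₂ after-oq) → take-slot C Xq oq₁ refl after-oq ℚP.≤-refl ℚP.≤-refl (Xq-takes-outer tt)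
    (inj₁ oq-in) → case InHead? oq₁ of λ where
      (yes head) → translate-slot C Xq oq₁ refl tt after-op oq-in head refl ℚP.≤-refl dp₁≤dq₁ (inj₂ (Xq-takes-outer tt))
      (no late) → case iq₁-position of λ where
        (inj₁ iq-in) → ⊥-elim (no-two-late-q-in-gap iq₁ oq₁ (λ ()) refl refl iq-in oq-in iq₁-not-in-head late)
        (inj₂ after-iq) → take-slot C Xq iq₁ refl after-iq ℚP.≤-refl d'q₁≤dq₁ (Xq-takes-inner (oq-in , late))

  record Deeper (C : GapCase) (x : New) : Set where
    field
      level : Fin n
      same-length : len (T' C x) ≡ len (T (lift x))
      release-moved : ⟦ release (T' C x) ⟧ℤ ≡ ⟦ release (T (lift x)) ⟧ℤ + D
      release≤0 : ⟦ release (T' C x) ⟧ℤ ≤q 0ℚ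
      same-deadline : deadline (T (lift x)) ≡ deadline (T' C x)
      deadline≥0 : 0ℚ ≤q ⟦ deadline (T' C x) ⟧ℤ
      not-level₁ : ¬ Level₁ (lift x)
      ≢sep₁ : lift x ≢ sep₁
      ≢sep₂ : lift x ≢ sep₂ level

  deeper-target : ∀ C x → Deeper C x → (InGap (lift x) → Target C x) → Target C x
  deeper-target C x d gap-target = case placement (Deeper.level d) (lift x) (Deeper.≢sep₁ d) (Deeper.≢sep₂ d) of λ where
    (is-after starts-after) →
      target (lift x) kept (Deeper.same-length d) starts-after
        (Deeper.release≤0 d ⟨≤⟩ starts-after , ≤-cong refl (cong ⟦_⟧ℤ (Deeper.same-deadline d)) (proj₂ (window (lift x))))
        (inj₁ (refl , Deeper.not-level₁ d)) (λ ())
    (is-deep ends-before) →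
      target (lift x) shifted (Deeper.same-length d) (ends-before ⟨≤⟩ -Q≤0)
        (≤-cong (sym (Deeper.release-moved d)) refl (+-monoˡ D (proj₁ (window (lift x))))
          , (ends-before ⟨≤⟩ -Q≤0 ⟨≤⟩ Deeper.deadline≥0 d))
        (inj₁ (refl , Deeper.not-level₁ d)) (λ ())
    (is-in-gap x-in) → gap-target x-in

  -- A deeper p-task in the gap takes the slot of J^O_p[1]: this happens only
  -- when another p-task than J^I_p[1] is in the gap.
  p-in-gap-target : ∀ C x → (d : Deeper C x) → len (T' C x) ≡ p → L (lift x) ≡ P →
    ⟦ dp zero ⟧ℤ ≤q ⟦ deadline (T' C x) ⟧ℤ →
    ((∀ i → ¬ InGap (ipIdx (suc i))) → (∀ i → ¬ InGap (opIdx (suc i))) → ¬ InGap (lift x)) →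
    InGap (lift x) → Target C x
  p-in-gap-target (inner-p-in-gap ip-in) x d _ Lx _ _ x-in =
    ⊥-elim (no-two-p-in-gap ip₁ (lift x) (Level₁≢ tt (Deeper.not-level₁ d)) refl Lx ip-in x-in)
  p-in-gap-target C@(other-p-in-gap _ _) x d lp Lx dl _ x-in = case op₁-position of λ where
    (inj₁ op-in) → ⊥-elim (no-two-p-in-gap op₁ (lift x) (Level₁≢ tt (Deeper.not-level₁ d)) refl Lx op-in x-in)
    (inj₂ after-op) → take-slot C x op₁ lp after-op (Deeper.release≤0 d) dl (p-takes x-in Lx tt)
  p-in-gap-target (only-q-in-gap _ _ no-ip no-op) x d _ _ _ not-in x-in = ⊥-elim (not-in no-ip no-op x-in)

  q-in-gap-target : ∀ C x → (d : Deeper C x) → len (T' C x) ≡ q → L (lift x) ≡ Q →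
    ⟦ dq zero ⟧ℤ ≤q ⟦ deadline (T' C x) ⟧ℤ → InGap (lift x) → Target C x
  q-in-gap-target C@(inner-p-in-gap ip-in) x d lq Lx dl x-in = case oq₁-position of λ where
    (inj₁ oq-in) → ⊥-elim (no-pqq-in-gap ip₁ oq₁ (lift x) (oq₁≢lift x) (λ ()) (Level₁≢ tt (Deeper.not-level₁ d))
                                         refl refl Lx ip-in oq-in x-in)
    (inj₂ after-oq) → take-slot C x oq₁ lq after-oq (Deeper.release≤0 d) dl (q-takes x-in Lx tt)
  q-in-gap-target C@(other-p-in-gap _ w) x d lq Lx dl x-in = case iq₁-position of λ where
    (inj₁ iq-in) → ⊥-elim (q-with-gap-p w iq₁ (lift x) (Level₁≢ tt (Deeper.not-level₁ d)) refl Lx iq-in x-in)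
    (inj₂ after-iq) → take-slot C x iq₁ lq after-iq (Deeper.release≤0 d) (d'q₁≤dq₁ ⟨≤⟩ dl) (q-takes x-in Lx tt)
  q-in-gap-target C@(only-q-in-gap _ after-op _ _) x d lq Lx dl x-in = case InHead? (lift x) of λ where
    (yes head) → translate-slot C x (lift x) (Deeper.same-length d) tt after-op x-in head Lx
                                (Deeper.release≤0 d) (dp₁≤dq₁ ⟨≤⟩ dl) (inj₁ (refl , Deeper.not-level₁ d))
    (no late) → case iq₁-position of λ where
      (inj₁ iq-in) → ⊥-elim (no-two-late-q-in-gap iq₁ (lift x) (Level₁≢ tt (Deeper.not-level₁ d)) refl Lx
                                                  iq-in x-in iq₁-not-in-head late)
      (inj₂ after-iq) → take-slot C x iq₁ lq after-iq (Deeper.release≤0 d) (d'q₁≤dq₁ ⟨≤⟩ dl) (q-takes x-in Lx late)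

  deeper-ip : ∀ C k → Deeper C (ipIdx k)
  deeper-ip C k = record
    { level = k ; same-length = refl ; release-moved = inner-release-step k p
    ; release≤0 = inner-release≤0 k p ; same-deadline = refl
    ; deadline≥0 = dp₁≥0 ⟨≤⟩ ⟦⟧-mono-≤ (chain-head-≤' chain-p k)
    ; not-level₁ = λ () ; ≢sep₁ = λ () ; ≢sep₂ = λ () }

  deeper-op : ∀ C k → Deeper C (opIdx k)
  deeper-op C k = record
    { level = k ; same-length = refl ; release-moved = outer-release-step k
    ; release≤0 = outer-release≤0 k ; same-deadline = refl
    ; deadline≥0 = dp₁≥0 ⟨≤⟩ ⟦⟧-mono-≤ (chain-head-≤ chain-p k)
    ; not-level₁ = λ () ; ≢sep₁ = λ () ; ≢sep₂ = λ () }

  deeper-iq : ∀ C k → Deeper C (iqIdx k)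
  deeper-iq C k = record
    { level = k ; same-length = refl ; release-moved = inner-release-step k q
    ; release≤0 = inner-release≤0 k q ; same-deadline = refl
    ; deadline≥0 = dp₁≥0 ⟨≤⟩ dp₁≤dq₁ ⟨≤⟩ ⟦⟧-mono-≤ (chain-head-≤' chain-q k)
    ; not-level₁ = λ () ; ≢sep₁ = λ () ; ≢sep₂ = λ () }

  deeper-oq : ∀ C k → Deeper C (oqIdx k)
  deeper-oq C k = record
    { level = k ; same-length = refl ; release-moved = outer-release-step k
    ; release≤0 = outer-release≤0 k ; same-deadline = refl
    ; deadline≥0 = dp₁≥0 ⟨≤⟩ dp₁≤dq₁ ⟨≤⟩ ⟦⟧-mono-≤ (chain-head-≤ chain-q k)
    ; not-level₁ = λ () ; ≢sep₁ = λ () ; ≢sep₂ = λ () }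

  target-of : ∀ C x → Target C x
  target-of C (jIdx zero) = Xp-target C
  target-of C (jIdx (suc zero)) = Xq-target C
  target-of C (jIdx (suc (suc k))) = J-target C k
  target-of C (sepIdx k) = sep-target C k
  target-of C (ipIdx k) = deeper-target C (ipIdx k) (deeper-ip C k)
    (p-in-gap-target C (ipIdx k) (deeper-ip C k) refl refl (⟦⟧-mono-≤ (chain-head-≤' chain-p k)) (λ no-ip _ → no-ip k))
  target-of C (opIdx k) = deeper-target C (opIdx k) (deeper-op C k)
    (p-in-gap-target C (opIdx k) (deeper-op C k) refl refl (⟦⟧-mono-≤ (chain-head-≤ chain-p k)) (λ _ no-op → no-op k))
  target-of C (iqIdx k) = deeper-target C (iqIdx k) (deeper-iq C k)
    (q-in-gap-target C (iqIdx k) (deeper-iq C k) refl refl (⟦⟧-mono-≤ (chain-head-≤' chain-q k)))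
  target-of C (oqIdx k) = deeper-target C (oqIdx k) (deeper-oq C k)
    (q-in-gap-target C (oqIdx k) (deeper-oq C k) refl refl (⟦⟧-mono-≤ (chain-head-≤ chain-q k)))

  -- Running every new task at its target is a feasible schedule of the peeled
  -- stacked instance: targets of distinct tasks have distinct slots, and a
  -- translated task never meets a kept J^O_p[1].
  peeled-feasible : ∀ C → Feasible (T' C)
  peeled-feasible C = start , feasible-intro (T' C) start (λ x → L (slot x)) (λ x → cong ⟦_⟧ℕ (Target.same-length (target-of C x)))
                                             (λ x → Target.in-window (target-of C x)) distinct
    where
    slot : New → Old
    slot x = Target.slot (target-of C x)
    kind : New → Kind
    kind x = Target.kind (target-of C x)
    start : New → ℚ
    start x = at (kind x) (slot x)

    Origin : New → Set
    Origin x = ((slot x ≡ lift x) × ¬ Level₁ (slot x)) ⊎ Takes C x (slot x)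

    distinct-origins : ∀ x y → x ≢ y → Origin x → Origin y → slot x ≢ slot y
    distinct-origins x y x≢y (inj₁ (sx , _)) (inj₁ (sy , _)) eq = lift-injective x≢y (trans (sym sx) (trans eq sy))
    distinct-origins x y x≢y (inj₁ (_ , ¬x₁)) (inj₂ ty) eq = ¬x₁ (subst Level₁ (sym eq) (takes-level₁ C ty))
    distinct-origins x y x≢y (inj₂ tx) (inj₁ (_ , ¬y₁)) eq = ¬y₁ (subst Level₁ eq (takes-level₁ C tx))
    distinct-origins x y x≢y (inj₂ tx) (inj₂ ty) eq = takes-unique C x≢y tx (subst (Takes C y) (sym eq) ty)

    op₁-free : ∀ x y → kind x ≡ translated → kind y ≡ kept → slot y ≢ op₁
    op₁-free x y tx _ = case Target.origin (target-of C y) of λ where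
      (inj₁ (_ , ¬y₁)) → λ eq → ¬y₁ (subst Level₁ (sym eq) tt)
      (inj₂ ty) → takes-not-op₁ C (Target.translated-only-q (target-of C x) tx) ty

    distinct : ∀ x y → x ≢ y → Disjoint (start x) (L (slot x)) (start y) (L (slot y))
    distinct x y x≢y =
      slots-disjoint (kind x) (kind y) (slot x) (slot y) (Target.fits (target-of C x)) (Target.fits (target-of C y))
        (distinct-origins x y x≢y (Target.origin (target-of C x)) (Target.origin (target-of C y)))
        (op₁-free x y) (op₁-free y x)

yes-of-stacked : ∀ (p q : ℕ) → 1 ≤ q → q < p →
  ∀ N m (J : Fin m → Task) (d'p dp d'q dq : Fin N → ℤ) →
  ValidAUX p q (mkAUX m J N d'p dp d'q dq) →
  Feasible (stackedTasks p q (mkAUX m J N d'p dp d'q dq)) →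
  YesInstance p q (mkAUX m J N d'p dp d'q dq)
yes-of-stacked p q q≥1 q<p zero m J d'p dp d'q dq _ feasible = yes-of-empty m J d'p dp d'q dq feasible
yes-of-stacked p q q≥1 q<p (suc n) m J d'p dp d'q dq valid (σ , F) =
  peel-yes m J n d'p dp d'q dq (ep C) (eq C) (ep≤dp₁ C) (eq≤dq₁ C) (tight C)
    (yes-of-stacked p q q≥1 q<p n (suc (suc m)) (extendJ p q (ep C) (eq C) J)
       (λ i → d'p (suc i)) (λ i → dp (suc i)) (λ i → d'q (suc i)) (λ i → dq (suc i))
       (peel-valid m J n d'p dp d'q dq (ep C) (eq C) valid) (peeled-feasible C))
  where
  open Reduction p q q≥1 q<p m J n d'p dp d'q dq valid σ F
  C : GapCase
  C = gap-case

mainTheorem5 : (p q : ℕ) → 1 ≤ q → q < p →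
    (inst : AUXInstance p q) → ValidAUX p q inst →
    Feasible (stackedTasks p q inst) →
    YesInstance p q inst
mainTheorem5 p q q≥1 q<p inst = yes-of-stacked p q q≥1 q<p N m J d'p dp d'q dq
  where open AUXInstance inst
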